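{- Let $G$ be a finite abelian group, let $A,B\subseteq G$ be subsets with $|A|+|B|\geq |G|+1$, and let $\tau: A\to G$ be an injective map. Then \[ |A\overset{\tau}{+} B| \geq |G| + \frac{1-4\sqrt{3\min\{|A|,|B|\}}}{3}. \]
   Context: For subsets $A,B$ of an abelian group $G$ and a map $\tau:A\to G$, the restricted sumset is $A\overset{\tau}{+} B=\{a+b: a\in A,\ b\in B,\ b\neq \tau(a)\}$. -}

module Defs where

open import Data.Nat using (ℕ)
open import Data.Fin using (Fin)
open import Data.Fin.Subset using (Subset; _∈_)
open import Data.Product using (∃₂; _×_)
open import Relation.Binary.PropositionalEquality using (_≡_; _≢_)
open import Algebra.Structures using (IsAbelianGroup)
open import Function.Bundles using (_⇔_)

-- A finite abelian group of order n, presented on the carrier Fin n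
-- (every finite abelian group is isomorphic to one of this form),
-- with propositional equality as the group equality.
record FinAbGroup (n : ℕ) : Set where
  field
    _∙_ : Fin n → Fin n → Fin n
    ε   : Fin n
    _⁻¹ : Fin n → Fin n
    isAbelianGroup : IsAbelianGroup _≡_ _∙_ ε _⁻¹

open FinAbGroup public

-- τ : A → G, represented as a total function Fin n → Fin n whose values
-- outside A are irrelevant; injectivity is required on A only.
InjectiveOn : {n : ℕ} → Subset n → (Fin n → Fin n) → Set
InjectiveOn A τ = ∀ {a a'} → a ∈ A → a' ∈ A → τ a ≡ τ a' → a ≡ a'

IsRestrictedSumset : {n : ℕ} → FinAbGroup n → Subset n → Subset n →
                     (Fin n → Fin n) → Subset n → Set
IsRestrictedSumset G A B τ S =
  ∀ x → (x ∈ S) ⇔ (∃₂ λ a b → a ∈ A × b ∈ B × b ≢ τ a × _∙_ G a b ≡ x)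

-- An element x outside the restricted sumset S has only representations x = a ∙ b with
-- b = τ a, so on the complement M of S these representations form a partial matching
-- between A and B. Let r x count the representations and t = ∣ M ∣. Inclusion–exclusion for
-- x - A, y - A and B gives ∣ B ∣ + 2 ∣ A ∣ ≤ n + r x + r y + ∣ A ∩ (A - (y - x)) ∣, while the
-- matching makes the conditions d ∙ a ∈ A, x - a ∈ B, x′ - a ∈ B mutually exclusive when
-- x ≠ x′ and x, x′, d ∙ x, d ∙ x′ ∈ M. Together they force r x′ < r (d ∙ x), so M is a Sidon
-- set. Summing the first bound over M × M, using Σ r ≤ ∣ A ∣ and the Sidon property to bound
-- the intersection terms by ∣ A ∣² + t ∣ A ∣, gives t² (∣ A ∣ + 1) ≤ ∣ A ∣² + 3 t ∣ A ∣ and hence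
-- (3t + 1)² ≤ 48 ∣ A ∣; by symmetry the same holds for B, and 3t + 1 = 3n + 1 - 3 ∣ S ∣.

module Submission where

open import Algebra.Bundles using (AbelianGroup)
import Algebra.Properties.AbelianGroup as AbelianGroupProperties
open import Data.Fin using (Fin; zero; suc)
open import Data.Fin.Permutation using (permutation)
open import Data.Fin.Properties using (suc-injective; 0≢1+n; _≟_)
open import Data.Fin.Subset using (Subset; ∣_∣; _∈_; inside; outside; ∁)
open import Data.Fin.Subset.Properties using (_∈?_; ∣p∣≤n; ∣∁p∣≡n∸∣p∣; x∈∁p⇒x∉p)
open import Data.Integer as ℤ using (+_)
import Data.Integer.Properties as ℤ
open import Data.List.Base using (_∷_; [])
open import Data.Nat using (ℕ; zero; suc; _+_; _*_; _∸_; _≤_; _<_; _≥_; _⊓_; z≤n; s≤s; z<s; _≤?_; _<?_)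
open import Data.Nat.Properties
  using (≤-refl; ≤-reflexive; ≤-trans; n≤1+n; m≤m+n; m≤n+m; m<m+n; <⇒≱; <⇒≯; ≰⇒>; ≮⇒≥; m≤n⇒∃[o]m+o≡n
        ; +-comm; +-identityʳ; +-mono-≤; +-monoˡ-≤; +-monoʳ-≤; +-cancelˡ-≤; +-cancelʳ-≤; +-∸-comm
        ; *-comm; *-assoc; *-identityˡ; *-identityʳ; *-distribˡ-+; *-distribˡ-∸; *-distribˡ-⊓
        ; *-mono-≤; *-monoˡ-≤; *-monoʳ-≤; ⊓-glb; +-*-semiring; *-commutativeSemigroup
        ; module ≤-Reasoning)
open import Data.Nat.Tactic.RingSolver using (solve)
open import Data.Product using (_,_)
open import Data.Sum using (_⊎_; inj₂)
open import Function using (_∘_; Equivalence)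
open import Level using (0ℓ)
open import Relation.Binary.PropositionalEquality
  using (_≡_; _≢_; refl; sym; trans; cong; cong₂; subst; module ≡-Reasoning)
open import Relation.Nullary using (Dec; yes; no; ¬_; contradiction)
open import Relation.Nullary.Decidable using (map′; _×-dec_; decidable-stable)
open import Relation.Unary using (Pred; Decidable)
open import Algebra.Properties.CommutativeSemigroup *-commutativeSemigroup using (x∙yz≈y∙xz)
open import Algebra.Properties.Semiring.Sum +-*-semiring
  using (sum; ∑-distrib-+; ∑-comm; sum-cong-≗; sum-permute; *-distribˡ-sum; *-distribʳ-sum)

open import Defs using (FinAbGroup; isAbelianGroup; InjectiveOn; IsRestrictedSumset)

𝟙 : ∀ {p} {P : Set p} → Dec P → ℕ
𝟙 (yes _) = 1
𝟙 (no _)  = 0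

𝟙≤1 : ∀ {p} {P : Set p} (P? : Dec P) → 𝟙 P? ≤ 1
𝟙≤1 (yes _) = s≤s z≤n
𝟙≤1 (no _)  = z≤n

𝟙-map′ : ∀ {p q} {P : Set p} {Q : Set q} (f : P → Q) (g : Q → P) (P? : Dec P) →
         𝟙 (map′ f g P?) ≡ 𝟙 P?
𝟙-map′ f g (yes _) = refl
𝟙-map′ f g (no _)  = refl

𝟙-× : ∀ {p q} {P : Set p} {Q : Set q} (P? : Dec P) (Q? : Dec Q) →
      𝟙 (P? ×-dec Q?) ≡ 𝟙 P? * 𝟙 Q?
𝟙-× (yes _) (yes _) = refl
𝟙-× (yes _) (no _)  = refl
𝟙-× (no _)  _       = refl

𝟙-bonferroni : ∀ {p q r} {P : Set p} {Q : Set q} {R : Set r} (P? : Dec P) (Q? : Dec Q) (R? : Dec R) →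
               𝟙 P? + (𝟙 Q? + 𝟙 R?) ≤ 1 + (𝟙 P? * 𝟙 Q? + (𝟙 P? * 𝟙 R? + 𝟙 Q? * 𝟙 R?))
𝟙-bonferroni (yes _) (yes _) (yes _) = n≤1+n 3
𝟙-bonferroni (yes _) (yes _) (no _)  = ≤-refl
𝟙-bonferroni (yes _) (no _)  (yes _) = ≤-refl
𝟙-bonferroni (yes _) (no _)  (no _)  = ≤-refl
𝟙-bonferroni (no _)  (yes _) (yes _) = ≤-refl
𝟙-bonferroni (no _)  (yes _) (no _)  = ≤-refl
𝟙-bonferroni (no _)  (no _)  (yes _) = ≤-refl
𝟙-bonferroni (no _)  (no _)  (no _)  = z≤n

𝟙-exclusive₃ : ∀ {p q r} {P : Set p} {Q : Set q} {R : Set r} (P? : Dec P) (Q? : Dec Q) (R? : Dec R) →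
               (P → ¬ Q) → (P → ¬ R) → (Q → ¬ R) → 𝟙 P? + (𝟙 Q? + 𝟙 R?) ≤ 1
𝟙-exclusive₃ (yes p) (yes q) _       p#q p#r q#r = contradiction q (p#q p)
𝟙-exclusive₃ (yes p) (no _)  (yes r) p#q p#r q#r = contradiction r (p#r p)
𝟙-exclusive₃ (yes _) (no _)  (no _)  _   _   _   = ≤-refl
𝟙-exclusive₃ (no _)  (yes q) (yes r) p#q p#r q#r = contradiction r (q#r q)
𝟙-exclusive₃ (no _)  (yes _) (no _)  _   _   _   = ≤-refl
𝟙-exclusive₃ (no _)  (no _)  (yes _) _   _   _   = ≤-refl
𝟙-exclusive₃ (no _)  (no _)  (no _)  _   _   _   = z≤n

sum-mono-≤ : ∀ {n} {f g : Fin n → ℕ} → (∀ i → f i ≤ g i) → sum f ≤ sum g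
sum-mono-≤ {zero}  f≤g = z≤n
sum-mono-≤ {suc n} f≤g = +-mono-≤ (f≤g zero) (sum-mono-≤ (f≤g ∘ suc))

sum-const : ∀ n c → sum {n} (λ _ → c) ≡ n * c
sum-const zero    c = refl
sum-const (suc n) c = cong (_+_ c) (sum-const n c)

∑-distrib-+₃ : ∀ {n} (f g h : Fin n → ℕ) → sum (λ i → f i + (g i + h i)) ≡ sum f + (sum g + sum h)
∑-distrib-+₃ f g h = trans (∑-distrib-+ f (λ i → g i + h i)) (cong (_+_ (sum f)) (∑-distrib-+ g h))

sum-𝟙-empty : ∀ {n p} {P : Pred (Fin n) p} (P? : Decidable P) →
              (∀ i → ¬ P i) → sum (𝟙 ∘ P?) ≡ 0
sum-𝟙-empty {zero}  P? ¬P = refl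
sum-𝟙-empty {suc n} P? ¬P with P? zero
... | yes p = contradiction p (¬P zero)
... | no  _ = sum-𝟙-empty (P? ∘ suc) (¬P ∘ suc)

sum-𝟙-unique : ∀ {n p} {P : Pred (Fin n) p} (P? : Decidable P) →
               (∀ {i j} → P i → P j → i ≡ j) → sum (𝟙 ∘ P?) ≤ 1
sum-𝟙-unique {zero}  P? unique = z≤n
sum-𝟙-unique {suc n} P? unique with P? zero
... | yes p = ≤-reflexive (cong suc (sum-𝟙-empty (P? ∘ suc) (λ i q → 0≢1+n (unique p q))))
... | no  _ = sum-𝟙-unique (P? ∘ suc) (λ p q → suc-injective (unique p q))

-- Vec's constructors stay local: overloaded with List's, they make the ring solver's
-- variable lists ambiguous and its elaboration blow up.
module _ where

  open import Data.Vec.Base using (_∷_; [])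

  ∣p∣≡sum-𝟙 : ∀ {n} (p : Subset n) → ∣ p ∣ ≡ sum (λ x → 𝟙 (x ∈? p))
  ∣p∣≡sum-𝟙 []            = refl
  ∣p∣≡sum-𝟙 (inside  ∷ p) = cong suc (trans (∣p∣≡sum-𝟙 p) (sum-cong-≗ (λ x → sym (𝟙-map′ _ _ (x ∈? p)))))
  ∣p∣≡sum-𝟙 (outside ∷ p) = trans (∣p∣≡sum-𝟙 p) (sum-cong-≗ (λ x → sym (𝟙-map′ _ _ (x ∈? p))))

module _ {n : ℕ} where

  ∑∈ : Subset n → (Fin n → ℕ) → ℕ
  ∑∈ p f = sum (λ x → 𝟙 (x ∈? p) * f x)

  syntax ∑∈ p (λ x → f) = ∑[ x ∈ p ] f

  ∑∈-+ : ∀ p (f g : Fin n → ℕ) → ∑[ x ∈ p ] (f x + g x) ≡ ∑[ x ∈ p ] f x + ∑[ x ∈ p ] g x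
  ∑∈-+ p f g = trans (sum-cong-≗ (λ x → *-distribˡ-+ (𝟙 (x ∈? p)) (f x) (g x)))
                     (∑-distrib-+ (λ x → 𝟙 (x ∈? p) * f x) (λ x → 𝟙 (x ∈? p) * g x))

  ∑∈-*ˡ : ∀ p c (f : Fin n → ℕ) → ∑[ x ∈ p ] (c * f x) ≡ c * ∑[ x ∈ p ] f x
  ∑∈-*ˡ p c f = trans (sum-cong-≗ (λ x → x∙yz≈y∙xz (𝟙 (x ∈? p)) c (f x)))
                      (sym (*-distribˡ-sum c (λ x → 𝟙 (x ∈? p) * f x)))

  ∑∈-const : ∀ p c → ∑[ x ∈ p ] c ≡ ∣ p ∣ * c
  ∑∈-const p c = begin
    sum (λ x → 𝟙 (x ∈? p) * c)  ≡⟨ *-distribʳ-sum c (λ x → 𝟙 (x ∈? p)) ⟨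
    sum (λ x → 𝟙 (x ∈? p)) * c  ≡⟨ cong (_* c) (∣p∣≡sum-𝟙 p) ⟨
    ∣ p ∣ * c                   ∎
    where open ≡-Reasoning

  ∑∈-mono-≤ : ∀ p {f g : Fin n → ℕ} → (∀ {x} → x ∈ p → f x ≤ g x) → ∑[ x ∈ p ] f x ≤ ∑[ x ∈ p ] g x
  ∑∈-mono-≤ p f≤g = sum-mono-≤ λ x → 𝟙-mono x (x ∈? p)
    where
    𝟙-mono : ∀ x (x∈?p : Dec (x ∈ p)) → 𝟙 x∈?p * _ ≤ 𝟙 x∈?p * _
    𝟙-mono x (yes x∈p) = *-monoʳ-≤ 1 (f≤g x∈p)
    𝟙-mono x (no _)    = z≤n

  ∑∈-+₃ : ∀ p (f g h : Fin n → ℕ) →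
          ∑[ x ∈ p ] (f x + (g x + h x)) ≡ ∑[ x ∈ p ] f x + (∑[ x ∈ p ] g x + ∑[ x ∈ p ] h x)
  ∑∈-+₃ p f g h = trans (∑∈-+ p f (λ x → g x + h x)) (cong (_+_ (∑[ x ∈ p ] f x)) (∑∈-+ p g h))

  ∑∈-comm : ∀ p q (f : Fin n → Fin n → ℕ) →
            ∑[ x ∈ p ] ∑[ y ∈ q ] f x y ≡ ∑[ y ∈ q ] ∑[ x ∈ p ] f x y
  ∑∈-comm p q f = begin
    ∑[ x ∈ p ] ∑[ y ∈ q ] f x y
      ≡⟨ sum-cong-≗ (λ x → *-distribˡ-sum (𝟙 (x ∈? p)) (λ y → 𝟙 (y ∈? q) * f x y)) ⟩
    sum (λ x → sum (λ y → 𝟙 (x ∈? p) * (𝟙 (y ∈? q) * f x y)))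
      ≡⟨ ∑-comm (λ x y → 𝟙 (x ∈? p) * (𝟙 (y ∈? q) * f x y)) ⟩
    sum (λ y → sum (λ x → 𝟙 (x ∈? p) * (𝟙 (y ∈? q) * f x y)))
      ≡⟨ sum-cong-≗ (λ y → sum-cong-≗ (λ x → x∙yz≈y∙xz (𝟙 (x ∈? p)) (𝟙 (y ∈? q)) (f x y))) ⟩
    sum (λ y → sum (λ x → 𝟙 (y ∈? q) * (𝟙 (x ∈? p) * f x y)))
      ≡⟨ sum-cong-≗ (λ y → *-distribˡ-sum (𝟙 (y ∈? q)) (λ x → 𝟙 (x ∈? p) * f x y)) ⟨
    ∑[ y ∈ q ] ∑[ x ∈ p ] f x y
      ∎
    where open ≡-Reasoning

  ∑∈-𝟙-unique : ∀ p {ℓ} {P : Pred (Fin n) ℓ} (P? : Decidable P) →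
                (∀ {x y} → x ∈ p → P x → y ∈ p → P y → x ≡ y) → ∑[ x ∈ p ] 𝟙 (P? x) ≤ 1
  ∑∈-𝟙-unique p P? unique = begin
    ∑[ x ∈ p ] 𝟙 (P? x)
      ≡⟨ sum-cong-≗ (λ x → 𝟙-× (x ∈? p) (P? x)) ⟨
    sum (λ x → 𝟙 (x ∈? p ×-dec P? x))
      ≤⟨ sum-𝟙-unique (λ x → x ∈? p ×-dec P? x) (λ (x∈p , Px) (y∈p , Py) → unique x∈p Px y∈p Py) ⟩
    1
      ∎
    where open ≤-Reasoning

-- With a = 1 + a′ and t = a + 1 + k the right-hand side exceeds the left-hand side
-- by one plus a polynomial in a′ and k with nonnegative coefficients.
t≤a : ∀ {t a} → 1 ≤ a → t * t * (a + 1) ≤ a * a + 3 * t * a → t ≤ a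
t≤a {t} {a} 1≤a ineq with t ≤? a
... | yes t≤a = t≤a
... | no  t≰a with m≤n⇒∃[o]m+o≡n (≰⇒> t≰a) | m≤n⇒∃[o]m+o≡n 1≤a
...   | k , refl | a′ , refl = contradiction ineq (<⇒≱ (begin-strict
  (1 + a′) * (1 + a′) + 3 * (2 + a′ + k) * (1 + a′)
    <⟨ m<m+n _ z<s ⟩
  (1 + a′) * (1 + a′) + 3 * (2 + a′ + k) * (1 + a′)
    + suc ((1 + a′) * (1 + a′) * a′ + 2 * k * (1 + a′) * (1 + a′) + k * (1 + a′) + 2 * k
           + k * k * (1 + a′) + k * k)
    ≡⟨ solve (a′ ∷ k ∷ []) ⟩
  (2 + a′ + k) * (2 + a′ + k) * (1 + a′ + 1)
    ∎))
  where open ≤-Reasoning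

t*t<a+3t : ∀ {t a} → 1 ≤ a → t * t * (a + 1) ≤ a * a + 3 * t * a → t * t < a + 3 * t
t*t<a+3t {t} {a} 1≤a ineq with t * t <? a + 3 * t
... | yes t*t<a+3t = t*t<a+3t
... | no  t*t≮a+3t = contradiction ineq (<⇒≱ (begin-strict
  a * a + 3 * t * a    ≡⟨ solve (a ∷ t ∷ []) ⟩
  a * (a + 3 * t)      ≤⟨ *-monoʳ-≤ a a+3t≤t*t ⟩
  a * (t * t)          <⟨ m<m+n (a * (t * t)) (≤-trans 1≤a (≤-trans (m≤m+n a (3 * t)) a+3t≤t*t)) ⟩
  a * (t * t) + t * t  ≡⟨ solve (a ∷ t ∷ []) ⟩
  t * t * (a + 1)      ∎))
  where
  open ≤-Reasoning
  a+3t≤t*t : a + 3 * t ≤ t * t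
  a+3t≤t*t = ≮⇒≥ t*t≮a+3t

square-bound : ∀ {t a} → 1 ≤ a → t * t * (a + 1) ≤ a * a + 3 * t * a → (3 * t + 1) * (3 * t + 1) ≤ 48 * a
square-bound {t} {a} 1≤a ineq = begin
  (3 * t + 1) * (3 * t + 1)
    ≤⟨ m≤m+n _ (6 * t + 8) ⟩
  (3 * t + 1) * (3 * t + 1) + (6 * t + 8) ≡⟨ solve (t ∷ []) ⟩
  3 * (3 * (1 + t * t) + 4 * t)
    ≤⟨ *-monoʳ-≤ 3 (+-monoˡ-≤ (4 * t) (*-monoʳ-≤ 3 (t*t<a+3t {t} 1≤a ineq))) ⟩
  3 * (3 * (a + 3 * t) + 4 * t)
    ≡⟨ solve (a ∷ t ∷ []) ⟩
  3 * (3 * a + 13 * t)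
    ≤⟨ *-monoʳ-≤ 3 (+-monoʳ-≤ (3 * a) (*-monoʳ-≤ 13 (t≤a {t} 1≤a ineq))) ⟩
  3 * (3 * a + 13 * a)
    ≡⟨ solve (a ∷ []) ⟩
  48 * a
    ∎
  where open ≤-Reasoning

abelianGroup : ∀ {n} → FinAbGroup n → AbelianGroup 0ℓ 0ℓ
abelianGroup {n} G = record
  { Carrier        = Fin n
  ; _≈_            = _≡_
  ; _∙_            = FinAbGroup._∙_ G
  ; ε              = FinAbGroup.ε G
  ; _⁻¹            = FinAbGroup._⁻¹ G
  ; isAbelianGroup = isAbelianGroup G
  }

module _ {n : ℕ} (G : FinAbGroup n) where

  open AbelianGroup (abelianGroup G) using (_∙_; _⁻¹; ε; _-_; comm; assoc; inverseʳ; identityˡ)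
  open AbelianGroupProperties (abelianGroup G)
    using ( ⁻¹-anti-homo‿-; //-rightDividesˡ; //-rightDividesʳ; \\-leftDividesʳ
          ; identityˡ-unique; ∙-cancelˡ; ⁻¹-injective; ε⁻¹≈ε)

  x∙[y-x]≡y : ∀ x y → x ∙ (y - x) ≡ y
  x∙[y-x]≡y x y = trans (comm x (y - x)) (//-rightDividesˡ x y)

  z-[x-y]≡[z-x]∙y : ∀ x y z → z - (x - y) ≡ (z - x) ∙ y
  z-[x-y]≡[z-x]∙y x y z = begin
    z ∙ (x - y) ⁻¹   ≡⟨ cong (z ∙_) (⁻¹-anti-homo‿- x y) ⟩
    z ∙ (y ∙ x ⁻¹)    ≡⟨ cong (z ∙_) (comm y (x ⁻¹)) ⟩
    z ∙ (x ⁻¹ ∙ y)    ≡⟨ assoc z (x ⁻¹) y ⟨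
    (z - x) ∙ y      ∎
    where open ≡-Reasoning

  x-[x-y]≡y : ∀ x y → x - (x - y) ≡ y
  x-[x-y]≡y x y = trans (z-[x-y]≡[z-x]∙y x y x) (trans (cong (_∙ y) (inverseʳ x)) (identityˡ y))

  sum-translate : ∀ x (f : Fin n → ℕ) → sum f ≡ sum (λ d → f (d ∙ x))
  sum-translate x f = sum-permute f (permutation (_∙ x) (_- x) (//-rightDividesˡ x) (//-rightDividesʳ x))

  sum-reflect : ∀ x (f : Fin n → ℕ) → sum f ≡ sum (λ y → f (x - y))
  sum-reflect x f = sum-permute f (permutation (x -_) (x -_) (x-[x-y]≡y x) (x-[x-y]≡y x))

  diffReps : Subset n → Fin n → ℕ
  diffReps X d = ∑[ x ∈ X ] 𝟙 (d ∙ x ∈? X)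

  diffReps≤∣X∣ : ∀ X d → diffReps X d ≤ ∣ X ∣
  diffReps≤∣X∣ X d = begin
    ∑[ x ∈ X ] 𝟙 (d ∙ x ∈? X)  ≤⟨ ∑∈-mono-≤ X (λ {x} _ → 𝟙≤1 (d ∙ x ∈? X)) ⟩
    ∑[ x ∈ X ] 1               ≡⟨ ∑∈-const X 1 ⟩
    ∣ X ∣ * 1                  ≡⟨ *-identityʳ ∣ X ∣ ⟩
    ∣ X ∣                      ∎
    where open ≤-Reasoning

  ∑-diffReps : ∀ X → sum (diffReps X) ≡ ∣ X ∣ * ∣ X ∣
  ∑-diffReps X = begin
    sum (λ d → sum (λ x → 𝟙 (x ∈? X) * 𝟙 (d ∙ x ∈? X)))
      ≡⟨ ∑-comm (λ d x → 𝟙 (x ∈? X) * 𝟙 (d ∙ x ∈? X)) ⟩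
    sum (λ x → sum (λ d → 𝟙 (x ∈? X) * 𝟙 (d ∙ x ∈? X)))
      ≡⟨ sum-cong-≗ (λ x → *-distribˡ-sum (𝟙 (x ∈? X)) (λ d → 𝟙 (d ∙ x ∈? X))) ⟨
    ∑[ x ∈ X ] sum (λ d → 𝟙 (d ∙ x ∈? X))
      ≡⟨ sum-cong-≗ (λ x → cong (𝟙 (x ∈? X) *_) ∣X∣≡translate) ⟨
    ∑[ x ∈ X ] ∣ X ∣
      ≡⟨ ∑∈-const X ∣ X ∣ ⟩
    ∣ X ∣ * ∣ X ∣
      ∎
    where
    open ≡-Reasoning
    ∣X∣≡translate : ∀ {x} → ∣ X ∣ ≡ sum (λ d → 𝟙 (d ∙ x ∈? X))
    ∣X∣≡translate {x} = trans (∣p∣≡sum-𝟙 X) (sum-translate x (λ y → 𝟙 (y ∈? X)))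

  ∑∑-diffReps : ∀ Y (f : Fin n → ℕ) → ∑[ x ∈ Y ] ∑[ y ∈ Y ] f (y - x) ≡ sum (λ d → f d * diffReps Y d)
  ∑∑-diffReps Y f = begin
    ∑[ x ∈ Y ] ∑[ y ∈ Y ] f (y - x)
      ≡⟨ sum-cong-≗ (λ x → cong (𝟙 (x ∈? Y) *_) (translated x)) ⟩
    ∑[ x ∈ Y ] sum (λ d → 𝟙 (d ∙ x ∈? Y) * f d)
      ≡⟨ sum-cong-≗ (λ x → *-distribˡ-sum (𝟙 (x ∈? Y)) (λ d → 𝟙 (d ∙ x ∈? Y) * f d)) ⟩
    sum (λ x → sum (λ d → 𝟙 (x ∈? Y) * (𝟙 (d ∙ x ∈? Y) * f d)))
      ≡⟨ ∑-comm (λ x d → 𝟙 (x ∈? Y) * (𝟙 (d ∙ x ∈? Y) * f d)) ⟩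
    sum (λ d → sum (λ x → 𝟙 (x ∈? Y) * (𝟙 (d ∙ x ∈? Y) * f d)))
      ≡⟨ sum-cong-≗ (λ d → sum-cong-≗ (λ x → rearrange (𝟙 (x ∈? Y)) (𝟙 (d ∙ x ∈? Y)) (f d))) ⟩
    sum (λ d → sum (λ x → f d * (𝟙 (x ∈? Y) * 𝟙 (d ∙ x ∈? Y))))
      ≡⟨ sum-cong-≗ (λ d → *-distribˡ-sum (f d) (λ x → 𝟙 (x ∈? Y) * 𝟙 (d ∙ x ∈? Y))) ⟨
    sum (λ d → f d * diffReps Y d)
      ∎
    where
    open ≡-Reasoning
    translated : ∀ x → sum (λ y → 𝟙 (y ∈? Y) * f (y - x)) ≡ sum (λ d → 𝟙 (d ∙ x ∈? Y) * f d)
    translated x = trans (sum-translate x (λ y → 𝟙 (y ∈? Y) * f (y - x)))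
                         (sum-cong-≗ (λ d → cong (λ z → 𝟙 (d ∙ x ∈? Y) * f z) (//-rightDividesʳ x d)))
    rearrange : ∀ u v w → u * (v * w) ≡ w * (u * v)
    rearrange u v w = trans (sym (*-assoc u v w)) (*-comm (u * v) w)

  sumReps : Subset n → Subset n → Fin n → ℕ
  sumReps A B x = ∑[ a ∈ A ] 𝟙 (x - a ∈? B)

  sumReps-comm : ∀ A B x → sumReps A B x ≡ sumReps B A x
  sumReps-comm A B x = begin
    sum (λ a → 𝟙 (a ∈? A) * 𝟙 (x - a ∈? B))
      ≡⟨ sum-reflect x (λ a → 𝟙 (a ∈? A) * 𝟙 (x - a ∈? B)) ⟩
    sum (λ b → 𝟙 (x - b ∈? A) * 𝟙 (x - (x - b) ∈? B))
      ≡⟨ sum-cong-≗ (λ b → cong (λ z → 𝟙 (x - b ∈? A) * 𝟙 (z ∈? B)) (x-[x-y]≡y x b)) ⟩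
    sum (λ b → 𝟙 (x - b ∈? A) * 𝟙 (b ∈? B))
      ≡⟨ sum-cong-≗ (λ b → *-comm (𝟙 (x - b ∈? A)) (𝟙 (b ∈? B))) ⟩
    sum (λ b → 𝟙 (b ∈? B) * 𝟙 (x - b ∈? A))
      ∎
    where open ≡-Reasoning

  common-diffReps : ∀ X x y → sum (λ g → 𝟙 (x - g ∈? X) * 𝟙 (y - g ∈? X)) ≡ diffReps X (y - x)
  common-diffReps X x y = begin
    sum (λ g → 𝟙 (x - g ∈? X) * 𝟙 (y - g ∈? X))
      ≡⟨ sum-reflect x (λ g → 𝟙 (x - g ∈? X) * 𝟙 (y - g ∈? X)) ⟩
    sum (λ a → 𝟙 (x - (x - a) ∈? X) * 𝟙 (y - (x - a) ∈? X))
      ≡⟨ sum-cong-≗ (λ a → cong₂ (λ u v → 𝟙 (u ∈? X) * 𝟙 (v ∈? X)) (x-[x-y]≡y x a) (z-[x-y]≡[z-x]∙y x a y)) ⟩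
    sum (λ a → 𝟙 (a ∈? X) * 𝟙 ((y - x) ∙ a ∈? X))
      ∎
    where open ≡-Reasoning

  sumset-bonferroni : ∀ A B x y →
    ∣ B ∣ + (∣ A ∣ + ∣ A ∣) ≤ n + (sumReps A B x + (sumReps A B y + diffReps A (y - x)))
  sumset-bonferroni A B x y = begin
    ∣ B ∣ + (∣ A ∣ + ∣ A ∣)
      ≡⟨ cong₂ _+_ (∣p∣≡sum-𝟙 B) (cong₂ _+_ (∣A∣≡sum x) (∣A∣≡sum y)) ⟩
    sum β + (sum α₁ + sum α₂)
      ≡⟨ ∑-distrib-+₃ β α₁ α₂ ⟨
    sum (λ g → β g + (α₁ g + α₂ g))
      ≤⟨ sum-mono-≤ (λ g → 𝟙-bonferroni (g ∈? B) (x - g ∈? A) (y - g ∈? A)) ⟩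
    sum (λ g → 1 + (β g * α₁ g + (β g * α₂ g + α₁ g * α₂ g)))
      ≡⟨ ∑-distrib-+ (λ _ → 1) (λ g → β g * α₁ g + (β g * α₂ g + α₁ g * α₂ g)) ⟩
    sum {n} (λ _ → 1) + sum (λ g → β g * α₁ g + (β g * α₂ g + α₁ g * α₂ g))
      ≡⟨ cong₂ _+_ (trans (sum-const n 1) (*-identityʳ n))
                   (∑-distrib-+₃ (λ g → β g * α₁ g) (λ g → β g * α₂ g) (λ g → α₁ g * α₂ g)) ⟩
    n + (sumReps B A x + (sumReps B A y + sum (λ g → α₁ g * α₂ g)))
      ≡⟨ cong (_+_ n) (cong₂ _+_ (sumReps-comm B A x)
                                 (cong₂ _+_ (sumReps-comm B A y) (common-diffReps A x y))) ⟩
    n + (sumReps A B x + (sumReps A B y + diffReps A (y - x)))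
      ∎
    where
    open ≤-Reasoning
    β α₁ α₂ : Fin n → ℕ
    β  g = 𝟙 (g ∈? B)
    α₁ g = 𝟙 (x - g ∈? A)
    α₂ g = 𝟙 (y - g ∈? A)
    ∣A∣≡sum : ∀ z → ∣ A ∣ ≡ sum (λ g → 𝟙 (z - g ∈? A))
    ∣A∣≡sum z = trans (∣p∣≡sum-𝟙 A) (sum-reflect z (λ a → 𝟙 (a ∈? A)))

  ∑∑-sumset-bonferroni : ∀ A B M →
    ∣ M ∣ * (∣ M ∣ * (∣ B ∣ + (∣ A ∣ + ∣ A ∣))) ≤
    ∣ M ∣ * (∣ M ∣ * n)
      + (∣ M ∣ * ∑[ x ∈ M ] sumReps A B x
         + (∣ M ∣ * ∑[ x ∈ M ] sumReps A B x + ∑[ x ∈ M ] ∑[ y ∈ M ] diffReps A (y - x)))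
  ∑∑-sumset-bonferroni A B M = begin
    t * (t * K)
      ≡⟨ trans (cong (λ z → ∑[ x ∈ M ] z) (∑∈-const M K)) (∑∈-const M (t * K)) ⟨
    ∑[ x ∈ M ] ∑[ y ∈ M ] K
      ≤⟨ ∑∈-mono-≤ M (λ {x} _ → ∑∈-mono-≤ M (λ {y} _ → sumset-bonferroni A B x y)) ⟩
    ∑[ x ∈ M ] ∑[ y ∈ M ] (n + (r x + (r y + diffReps A (y - x))))
      ≡⟨ sum-cong-≗ (λ x → cong (𝟙 (x ∈? M) *_) (inner x)) ⟩
    ∑[ x ∈ M ] (t * n + (t * r x + (e + W x)))
      ≡⟨ ∑∈-+₃ M (λ _ → t * n) (λ x → t * r x) (λ x → e + W x) ⟩
    ∑[ x ∈ M ] (t * n) + (∑[ x ∈ M ] (t * r x) + ∑[ x ∈ M ] (e + W x))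
      ≡⟨ cong₂ _+_ (∑∈-const M (t * n)) (cong₂ _+_ (∑∈-*ˡ M t r) (∑∈-+ M (λ _ → e) W)) ⟩
    t * (t * n) + (t * e + (∑[ x ∈ M ] e + D))
      ≡⟨ cong (λ z → t * (t * n) + (t * e + (z + D))) (∑∈-const M e) ⟩
    t * (t * n) + (t * e + (t * e + D))
      ∎
    where
    open ≤-Reasoning
    t = ∣ M ∣
    K = ∣ B ∣ + (∣ A ∣ + ∣ A ∣)
    r = sumReps A B
    e = ∑[ x ∈ M ] r x
    W : Fin n → ℕ
    W x = ∑[ y ∈ M ] diffReps A (y - x)
    D = ∑[ x ∈ M ] W x
    inner : ∀ x → ∑[ y ∈ M ] (n + (r x + (r y + diffReps A (y - x)))) ≡ t * n + (t * r x + (e + W x))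
    inner x = trans (∑∈-+₃ M (λ _ → n) (λ _ → r x) (λ y → r y + diffReps A (y - x)))
                    (cong₂ _+_ (∑∈-const M n) (cong₂ _+_ (∑∈-const M (r x)) (∑∈-+ M r (λ y → diffReps A (y - x)))))

  record SumsInMatching (A B M : Subset n) : Set where
    field
      unique-right : ∀ {a b b′} → a ∈ A → b ∈ B → b′ ∈ B → a ∙ b ∈ M → a ∙ b′ ∈ M → b ≡ b′
      unique-left  : ∀ {a a′ b} → a ∈ A → a′ ∈ A → b ∈ B → a ∙ b ∈ M → a′ ∙ b ∈ M → a ≡ a′

  SumsInMatching-swap : ∀ {A B M} → SumsInMatching A B M → SumsInMatching B A M
  SumsInMatching-swap {M = M} matching = record
    { unique-right = λ b∈B a∈A a′∈A ba∈M ba′∈M →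
        unique-left a∈A a′∈A b∈B (subst (_∈ M) (comm _ _) ba∈M) (subst (_∈ M) (comm _ _) ba′∈M)
    ; unique-left  = λ b∈B b′∈B a∈A ba∈M b′a∈M →
        unique-right a∈A b∈B b′∈B (subst (_∈ M) (comm _ _) ba∈M) (subst (_∈ M) (comm _ _) b′a∈M)
    }
    where open SumsInMatching matching

  module _ {A B M : Subset n} (matching : SumsInMatching A B M) where

    open SumsInMatching matching

    unique-sum : ∀ {a x x′} → a ∈ A → x ∈ M → x′ ∈ M → x - a ∈ B → x′ - a ∈ B → x ≡ x′
    unique-sum {a} {x} {x′} a∈A x∈M x′∈M x-a∈B x′-a∈B = begin
      x              ≡⟨ x∙[y-x]≡y a x ⟨
      a ∙ (x - a)    ≡⟨ cong (a ∙_) (unique-right a∈A x-a∈B x′-a∈B (∈M x∈M) (∈M x′∈M)) ⟩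
      a ∙ (x′ - a)   ≡⟨ x∙[y-x]≡y a x′ ⟩
      x′             ∎
      where
      open ≡-Reasoning
      ∈M : ∀ {z} → z ∈ M → a ∙ (z - a) ∈ M
      ∈M {z} = subst (_∈ M) (sym (x∙[y-x]≡y a z))

    unique-shift : ∀ {a d x} → a ∈ A → d ∙ a ∈ A → x ∈ M → d ∙ x ∈ M → x - a ∈ B → d ≡ ε
    unique-shift {a} {d} {x} a∈A da∈A x∈M dx∈M x-a∈B =
      identityˡ-unique d a (unique-left da∈A a∈A x-a∈B (subst (_∈ M) (sym shifted) dx∈M)
                                                       (subst (_∈ M) (sym (x∙[y-x]≡y a x)) x∈M))
      where
      shifted : d ∙ a ∙ (x - a) ≡ d ∙ x
      shifted = trans (assoc d a (x - a)) (cong (d ∙_) (x∙[y-x]≡y a x))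

    sumReps-disjoint : ∀ {d x x′} → d ≢ ε → x ≢ x′ → x ∈ M → x′ ∈ M → d ∙ x ∈ M → d ∙ x′ ∈ M →
                       diffReps A d + (sumReps A B x + sumReps A B x′) ≤ ∣ A ∣
    sumReps-disjoint {d} {x} {x′} d≢ε x≢x′ x∈M x′∈M dx∈M dx′∈M = begin
      diffReps A d + (sumReps A B x + sumReps A B x′)
        ≡⟨ cong (_+_ (diffReps A d)) (∑∈-+ A (λ a → 𝟙 (x - a ∈? B)) (λ a → 𝟙 (x′ - a ∈? B))) ⟨
      diffReps A d + ∑[ a ∈ A ] (𝟙 (x - a ∈? B) + 𝟙 (x′ - a ∈? B))
        ≡⟨ ∑∈-+ A (λ a → 𝟙 (d ∙ a ∈? A)) (λ a → 𝟙 (x - a ∈? B) + 𝟙 (x′ - a ∈? B)) ⟨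
      ∑[ a ∈ A ] (𝟙 (d ∙ a ∈? A) + (𝟙 (x - a ∈? B) + 𝟙 (x′ - a ∈? B)))
        ≤⟨ ∑∈-mono-≤ A (λ {a} a∈A → 𝟙-exclusive₃ (d ∙ a ∈? A) (x - a ∈? B) (x′ - a ∈? B)
             (λ da∈A x-a∈B → d≢ε (unique-shift a∈A da∈A x∈M dx∈M x-a∈B))
             (λ da∈A x′-a∈B → d≢ε (unique-shift a∈A da∈A x′∈M dx′∈M x′-a∈B))
             (λ x-a∈B x′-a∈B → x≢x′ (unique-sum a∈A x∈M x′∈M x-a∈B x′-a∈B))) ⟩
      ∑[ a ∈ A ] 1
        ≡⟨ trans (∑∈-const A 1) (*-identityʳ ∣ A ∣) ⟩
      ∣ A ∣
        ∎
      where open ≤-Reasoning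

    ∑-sumReps≤∣A∣ : ∑[ x ∈ M ] sumReps A B x ≤ ∣ A ∣
    ∑-sumReps≤∣A∣ = begin
      ∑[ x ∈ M ] ∑[ a ∈ A ] 𝟙 (x - a ∈? B)
        ≡⟨ ∑∈-comm M A (λ x a → 𝟙 (x - a ∈? B)) ⟩
      ∑[ a ∈ A ] ∑[ x ∈ M ] 𝟙 (x - a ∈? B)
        ≤⟨ ∑∈-mono-≤ A (λ a∈A → ∑∈-𝟙-unique M _ (λ x∈M x-a∈B x′∈M x′-a∈B → unique-sum a∈A x∈M x′∈M x-a∈B x′-a∈B)) ⟩
      ∑[ a ∈ A ] 1
        ≡⟨ trans (∑∈-const A 1) (*-identityʳ ∣ A ∣) ⟩
      ∣ A ∣
        ∎
      where open ≤-Reasoning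

    module _ (cover : n + 1 ≤ ∣ A ∣ + ∣ B ∣) where

      sumReps-increasing : ∀ {d x x′} → d ≢ ε → x ≢ x′ → x ∈ M → x′ ∈ M → d ∙ x ∈ M → d ∙ x′ ∈ M →
                           sumReps A B x′ < sumReps A B (d ∙ x)
      sumReps-increasing {d} {x} {x′} d≢ε x≢x′ x∈M x′∈M dx∈M dx′∈M =
        arithmetic ∣ A ∣ ∣ B ∣ (sumReps A B x) (sumReps A B x′) (sumReps A B (d ∙ x)) (diffReps A d)
            (subst (λ z → ∣ B ∣ + (∣ A ∣ + ∣ A ∣) ≤ n + (sumReps A B x + (sumReps A B (d ∙ x) + diffReps A z)))
                   (//-rightDividesʳ x d) (sumset-bonferroni A B x (d ∙ x)))
            (sumReps-disjoint d≢ε x≢x′ x∈M x′∈M dx∈M dx′∈M)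
            cover
        where
        arithmetic : ∀ a b r r′ s C → b + (a + a) ≤ n + (r + (s + C)) → C + (r + r′) ≤ a → n + 1 ≤ a + b → r′ < s
        arithmetic a b r r′ s C bonferroni disjoint n<a+b = +-cancelˡ-≤ (n + a) (suc r′) s (begin
          n + a + suc r′          ≡⟨ solve (n ∷ a ∷ r′ ∷ []) ⟩
          n + 1 + (a + r′)        ≤⟨ +-monoˡ-≤ (a + r′) n<a+b ⟩
          a + b + (a + r′)        ≡⟨ solve (a ∷ b ∷ r′ ∷ []) ⟩
          b + (a + a) + r′        ≤⟨ +-monoˡ-≤ r′ bonferroni ⟩
          n + (r + (s + C)) + r′  ≡⟨ solve (n ∷ r ∷ s ∷ C ∷ r′ ∷ []) ⟩
          n + s + (C + (r + r′))  ≤⟨ +-monoʳ-≤ (n + s) disjoint ⟩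
          n + s + a               ≡⟨ solve (n ∷ s ∷ a ∷ []) ⟩
          n + a + s               ∎)
          where open ≤-Reasoning

      diffReps-M≤1 : ∀ {d} → d ≢ ε → diffReps M d ≤ 1
      diffReps-M≤1 {d} d≢ε = ∑∈-𝟙-unique M (λ x → d ∙ x ∈? M) unique
        where
        d⁻¹≢ε : d ⁻¹ ≢ ε
        d⁻¹≢ε d⁻¹≡ε = d≢ε (⁻¹-injective (trans d⁻¹≡ε (sym ε⁻¹≈ε)))
        unique : ∀ {x x′} → x ∈ M → d ∙ x ∈ M → x′ ∈ M → d ∙ x′ ∈ M → x ≡ x′
        unique {x} {x′} x∈M dx∈M x′∈M dx′∈M with x ≟ x′
        ... | yes x≡x′ = x≡x′
        ... | no  x≢x′ = contradiction (sumReps-increasing d≢ε x≢x′ x∈M x′∈M dx∈M dx′∈M) (<⇒≯ back)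
          where
          back : sumReps A B (d ∙ x) < sumReps A B x′
          back = subst (λ z → sumReps A B (d ∙ x) < sumReps A B z) (\\-leftDividesʳ d x′)
                   (sumReps-increasing d⁻¹≢ε (x≢x′ ∘ sym ∘ ∙-cancelˡ d x′ x) dx′∈M dx∈M
                     (subst (_∈ M) (sym (\\-leftDividesʳ d x′)) x′∈M)
                     (subst (_∈ M) (sym (\\-leftDividesʳ d x)) x∈M))

      ∑∑-diffReps≤ : ∑[ x ∈ M ] ∑[ y ∈ M ] diffReps A (y - x) ≤ ∣ A ∣ * ∣ A ∣ + ∣ A ∣ * ∣ M ∣
      ∑∑-diffReps≤ = begin
        ∑[ x ∈ M ] ∑[ y ∈ M ] diffReps A (y - x)
          ≡⟨ ∑∑-diffReps M (diffReps A) ⟩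
        sum (λ d → diffReps A d * diffReps M d)
          ≤⟨ sum-mono-≤ diffReps-product≤ ⟩
        sum (λ d → diffReps A d + 𝟙 (d ≟ ε) * k)
          ≡⟨ ∑-distrib-+ (diffReps A) (λ d → 𝟙 (d ≟ ε) * k) ⟩
        sum (diffReps A) + sum (λ d → 𝟙 (d ≟ ε) * k)
          ≡⟨ cong₂ _+_ (∑-diffReps A) (sym (*-distribʳ-sum k (λ d → 𝟙 (d ≟ ε)))) ⟩
        ∣ A ∣ * ∣ A ∣ + sum (λ d → 𝟙 (d ≟ ε)) * k
          ≤⟨ +-monoʳ-≤ (∣ A ∣ * ∣ A ∣) (*-monoˡ-≤ k (sum-𝟙-unique (_≟ ε) (λ d≡ε d′≡ε → trans d≡ε (sym d′≡ε)))) ⟩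
        ∣ A ∣ * ∣ A ∣ + 1 * k
          ≡⟨ cong (_+_ (∣ A ∣ * ∣ A ∣)) (*-identityˡ k) ⟩
        ∣ A ∣ * ∣ A ∣ + k
          ∎
        where
        open ≤-Reasoning
        k = ∣ A ∣ * ∣ M ∣
        diffReps-product≤ : ∀ d → diffReps A d * diffReps M d ≤ diffReps A d + 𝟙 (d ≟ ε) * k
        diffReps-product≤ d with d ≟ ε
        ... | yes _ = begin
          diffReps A d * diffReps M d  ≤⟨ *-mono-≤ (diffReps≤∣X∣ A d) (diffReps≤∣X∣ M d) ⟩
          k                            ≤⟨ m≤n+m k (diffReps A d) ⟩
          diffReps A d + k             ≡⟨ cong (_+_ (diffReps A d)) (+-identityʳ k) ⟨
          diffReps A d + (k + 0)       ∎
        ... | no d≢ε = begin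
          diffReps A d * diffReps M d  ≤⟨ *-monoʳ-≤ (diffReps A d) (diffReps-M≤1 d≢ε) ⟩
          diffReps A d * 1             ≡⟨ *-identityʳ (diffReps A d) ⟩
          diffReps A d                 ≡⟨ +-identityʳ (diffReps A d) ⟨
          diffReps A d + 0             ∎

      matching-bound : ∣ M ∣ * ∣ M ∣ * (∣ A ∣ + 1) ≤ ∣ A ∣ * ∣ A ∣ + 3 * ∣ M ∣ * ∣ A ∣
      matching-bound = arithmetic (∣ M ∣) (∣ A ∣) (∣ B ∣) _ _
        (∑∑-sumset-bonferroni A B M) ∑-sumReps≤∣A∣ ∑∑-diffReps≤ cover
        where
        arithmetic : ∀ t a b e D → t * (t * (b + (a + a))) ≤ t * (t * n) + (t * e + (t * e + D)) →
                  e ≤ a → D ≤ a * a + a * t → n + 1 ≤ a + b → t * t * (a + 1) ≤ a * a + 3 * t * a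
        arithmetic t a b e D double-count e≤a D≤ n<a+b = +-cancelˡ-≤ (t * (t * n)) _ _ (begin
          t * (t * n) + t * t * (a + 1)
            ≡⟨ solve (t ∷ n ∷ a ∷ []) ⟩
          t * (t * (a + (n + 1)))
            ≤⟨ *-monoʳ-≤ t (*-monoʳ-≤ t (+-monoʳ-≤ a n<a+b)) ⟩
          t * (t * (a + (a + b)))
            ≡⟨ solve (t ∷ a ∷ b ∷ []) ⟩
          t * (t * (b + (a + a)))
            ≤⟨ double-count ⟩
          t * (t * n) + (t * e + (t * e + D))
            ≤⟨ +-monoʳ-≤ (t * (t * n)) (+-mono-≤ (*-monoʳ-≤ t e≤a) (+-mono-≤ (*-monoʳ-≤ t e≤a) D≤)) ⟩
          t * (t * n) + (t * a + (t * a + (a * a + a * t)))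
            ≡⟨ solve (t ∷ n ∷ a ∷ []) ⟩
          t * (t * n) + (a * a + 3 * t * a)
            ∎)
          where open ≤-Reasoning

      missing-bound : (3 * ∣ M ∣ + 1) * (3 * ∣ M ∣ + 1) ≤ 48 * ∣ A ∣
      missing-bound = square-bound {∣ M ∣} 1≤∣A∣ matching-bound
        where
        1≤∣A∣ : 1 ≤ ∣ A ∣
        1≤∣A∣ = +-cancelʳ-≤ n 1 ∣ A ∣ (begin
          1 + n          ≡⟨ +-comm 1 n ⟩
          n + 1          ≤⟨ cover ⟩
          ∣ A ∣ + ∣ B ∣  ≤⟨ +-monoʳ-≤ ∣ A ∣ (∣p∣≤n B) ⟩
          ∣ A ∣ + n      ∎)
          where open ≤-Reasoning

  restrictedSumset-complement-matching : ∀ {A B S τ} → InjectiveOn A τ → IsRestrictedSumset G A B τ S →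
                                         SumsInMatching A B (∁ S)
  restrictedSumset-complement-matching {A} {B} {S} {τ} τ-injective S-sumset = record
    { unique-right = λ a∈A b∈B b′∈B ab∈∁S ab′∈∁S → trans (forced a∈A b∈B ab∈∁S) (sym (forced a∈A b′∈B ab′∈∁S))
    ; unique-left  = λ a∈A a′∈A b∈B ab∈∁S a′b∈∁S →
        τ-injective a∈A a′∈A (trans (sym (forced a∈A b∈B ab∈∁S)) (forced a′∈A b∈B a′b∈∁S))
    }
    where
    forced : ∀ {a b} → a ∈ A → b ∈ B → a ∙ b ∈ ∁ S → b ≡ τ a
    forced {a} {b} a∈A b∈B ab∈∁S = decidable-stable (b ≟ τ a) λ b≢τa →
      x∈∁p⇒x∉p ab∈∁S (Equivalence.from (S-sumset (a ∙ b)) (a , b , a∈A , b∈B , b≢τa , refl))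

3n+1-3∣S∣≡3∣∁S∣+1 : ∀ {n} (S : Subset n) → + (3 * n + 1) ℤ.- + (3 * ∣ S ∣) ≡ + (3 * ∣ ∁ S ∣ + 1)
3n+1-3∣S∣≡3∣∁S∣+1 {n} S = begin
  + (3 * n + 1) ℤ.- + (3 * ∣ S ∣)  ≡⟨ ℤ.m-n≡m⊖n (3 * n + 1) (3 * ∣ S ∣) ⟩
  (3 * n + 1) ℤ.⊖ (3 * ∣ S ∣)      ≡⟨ ℤ.⊖-≥ (≤-trans 3∣S∣≤3n (m≤m+n (3 * n) 1)) ⟩
  + ((3 * n + 1) ∸ 3 * ∣ S ∣)      ≡⟨ cong +_ (+-∸-comm 1 3∣S∣≤3n) ⟩
  + (3 * n ∸ 3 * ∣ S ∣ + 1)        ≡⟨ cong (λ z → + (z + 1)) (sym (*-distribˡ-∸ 3 n ∣ S ∣)) ⟩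
  + (3 * (n ∸ ∣ S ∣) + 1)          ≡⟨ cong (λ z → + (3 * z + 1)) (sym (∣∁p∣≡n∸∣p∣ S)) ⟩
  + (3 * ∣ ∁ S ∣ + 1)              ∎
  where
  open ≡-Reasoning
  3∣S∣≤3n : 3 * ∣ S ∣ ≤ 3 * n
  3∣S∣≤3n = *-monoʳ-≤ 3 (∣p∣≤n S)

theorem3p2 : (n : ℕ) (G : FinAbGroup n) (A B : Subset n) (τ : Fin n → Fin n) →
    InjectiveOn A τ →
    ∣ A ∣ + ∣ B ∣ ≥ n + 1 →
    (S : Subset n) → IsRestrictedSumset G A B τ S →
    ((+ (3 * n + 1)) ℤ.- (+ (3 * ∣ S ∣)) ℤ.≤ + 0)
      ⊎ (((+ (3 * n + 1)) ℤ.- (+ (3 * ∣ S ∣))) ℤ.* ((+ (3 * n + 1)) ℤ.- (+ (3 * ∣ S ∣)))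
           ℤ.≤ + (48 * (∣ A ∣ ⊓ ∣ B ∣)))
theorem3p2 n G A B τ τ-injective cover S S-sumset = inj₂ (begin
  (+ (3 * n + 1) ℤ.- + (3 * ∣ S ∣)) ℤ.* (+ (3 * n + 1) ℤ.- + (3 * ∣ S ∣))
    ≡⟨ cong (λ z → z ℤ.* z) (3n+1-3∣S∣≡3∣∁S∣+1 S) ⟩
  + (3 * t + 1) ℤ.* + (3 * t + 1)
    ≡⟨ ℤ.pos-* (3 * t + 1) (3 * t + 1) ⟨
  + ((3 * t + 1) * (3 * t + 1))
    ≤⟨ ℤ.+≤+ (⊓-glb (missing-bound G matching cover) (missing-bound G (SumsInMatching-swap G matching) cover′)) ⟩
  + ((48 * ∣ A ∣) ⊓ (48 * ∣ B ∣))
    ≡⟨ cong +_ (*-distribˡ-⊓ 48 ∣ A ∣ ∣ B ∣) ⟨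
  + (48 * (∣ A ∣ ⊓ ∣ B ∣))
    ∎)
  where
  open ℤ.≤-Reasoning
  t = ∣ ∁ S ∣
  matching : SumsInMatching G A B (∁ S)
  matching = restrictedSumset-complement-matching G τ-injective S-sumset
  cover′ : n + 1 ≤ ∣ B ∣ + ∣ A ∣
  cover′ = ≤-trans cover (≤-reflexive (+-comm ∣ A ∣ ∣ B ∣))
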